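{- For any adaptive strategy tree $\mathcal{T}$ and any monotone non-negative submodular function $f:2^X\to\mathbb{R}_{\ge0}$ with $f(\emptyset)=0$, \[ \mathrm{alg}(\mathcal{T},f)\ \ge\ \tfrac13\,\mathrm{adap}(\mathcal{T},f). \]
   Context: Ground set $X$; each $e\in X$ has probability $p_e$, $q_e=1-p_e$. An adaptive strategy tree $\mathcal{T}$ is a rooted binary tree whose internal nodes $v$ are labelled by elements $\mathrm{elt}(v)\in X$, each with a yes-arc and a no-arc, with no element labelling two nodes on a root-leaf path. It induces a distribution $\pi_{\mathcal{T}}$ over leaves: starting at the root, at node $v$ follow the yes-arc with probability $p_{\mathrm{elt}(v)}$ and the no-arc otherwise. For a leaf $\ell$, let $P_\ell$ be its root path, $\mathrm{elt}(P_\ell)$ the elements labelling nodes on it, and $A_\ell$ the elements on $P_\ell$ whose yes-arc is taken on $P_\ell$. For a set function $f$ let $f^{\max}(S)=\max_{T\subseteq S}f(T)$. Define $\mathrm{adap}(\mathcal{T},f):=\mathbb{E}_{\ell\leftarrow\pi_{\mathcal{T}}}[f^{\max}(A_\ell)]$ and $\mathrm{alg}(\mathcal{T},f):=\mathbb{E}_{\ell\leftarrow\pi_{\mathcal{T}}}\big[\mathbb{E}_{R}[f^{\max}(R\cap\mathrm{elt}(P_\ell))]\big]$, where $R\subseteq X$ contains each $e$ independently with probability $p_e$ (independently of $\ell$).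
   Formalization: The probabilities p_e and the values of f are rational rather than real. -}

module Defs where

open import Data.Nat using (ℕ; zero; suc)
open import Data.Fin using (Fin; zero; suc)
open import Data.Fin.Subset using (Subset; ⊥; ⁅_⁆; _∈_; _∉_; _⊆_; _∩_; _∪_; inside; outside)
open import Data.Vec using (Vec; []; _∷_; lookup)
open import Data.List using (List; []; _∷_; map; _++_; foldr)
open import Data.Rational using (ℚ; 0ℚ; 1ℚ; _+_; _*_; _-_; _⊔_; _≤_)
open import Data.Product using (_×_)
open import Data.Unit using (⊤)

-- Adaptive strategy trees: node e yes no, labelled by an element e.
data Tree (n : ℕ) : Set where
  leaf : Tree n
  node : Fin n → Tree n → Tree n → Tree n

ValidFrom : ∀ {n} → Subset n → Tree n → Set
ValidFrom used leaf = ⊤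
ValidFrom used (node e y no) =
  e ∉ used × ValidFrom (used ∪ ⁅ e ⁆) y × ValidFrom (used ∪ ⁅ e ⁆) no

Valid : ∀ {n} → Tree n → Set
Valid t = ValidFrom ⊥ t

subsetsOf : ∀ {n} → Subset n → List (Subset n)
subsetsOf [] = [] ∷ []
subsetsOf (outside ∷ s) = map (outside ∷_) (subsetsOf s)
subsetsOf (inside ∷ s) = map (outside ∷_) (subsetsOf s) ++ map (inside ∷_) (subsetsOf s)

allSubsets : (n : ℕ) → List (Subset n)
allSubsets n = subsetsOf (Data.Fin.Subset.⊤)

-- f^max(S) = max_{T ⊆ S} f(T)   (∅ ⊆ S, so f ∅ is a valid starting value)
fmax : ∀ {n} → (Subset n → ℚ) → Subset n → ℚ
fmax f S = foldr _⊔_ (f ⊥) (map f (subsetsOf S))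

sumℚ : List ℚ → ℚ
sumℚ = foldr _+_ 0ℚ

probSet : ∀ {n} → (Fin n → ℚ) → Subset n → ℚ
probSet {zero} p [] = 1ℚ
probSet {suc n} p (inside ∷ r) = p zero * probSet (λ i → p (suc i)) r
probSet {suc n} p (outside ∷ r) = (1ℚ - p zero) * probSet (λ i → p (suc i)) r

expR : ∀ {n} → (Fin n → ℚ) → (Subset n → ℚ) → Subset n → ℚ
expR {n} p f E = sumℚ (map (λ R → probSet p R * fmax f (R ∩ E)) (allSubsets n))

-- adap(T,f) = E_ℓ [ f^max(A_ℓ) ];  A = yes-elements so far
adapFrom : ∀ {n} → (Fin n → ℚ) → (Subset n → ℚ) → Subset n → Tree n → ℚ
adapFrom p f A leaf = fmax f A
adapFrom p f A (node e y no) =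
  p e * adapFrom p f (A ∪ ⁅ e ⁆) y + (1ℚ - p e) * adapFrom p f A no

adap : ∀ {n} → (Fin n → ℚ) → Tree n → (Subset n → ℚ) → ℚ
adap p t f = adapFrom p f ⊥ t

-- alg(T,f) = E_ℓ [ E_R [ f^max(R ∩ elt(P_ℓ)) ] ];  E = elements on path so far
algFrom : ∀ {n} → (Fin n → ℚ) → (Subset n → ℚ) → Subset n → Tree n → ℚ
algFrom p f E leaf = expR p f E
algFrom p f E (node e y no) =
  p e * algFrom p f (E ∪ ⁅ e ⁆) y + (1ℚ - p e) * algFrom p f (E ∪ ⁅ e ⁆) no

alg : ∀ {n} → (Fin n → ℚ) → Tree n → (Subset n → ℚ) → ℚ
alg p t f = algFrom p f ⊥ t

Monotone : ∀ {n} → (Subset n → ℚ) → Set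
Monotone f = ∀ S T → S ⊆ T → f S ≤ f T

Submodular : ∀ {n} → (Subset n → ℚ) → Set
Submodular f = ∀ S T → f (S ∪ T) + f (S ∩ T) ≤ f S + f T

NonNeg : ∀ {n} → (Subset n → ℚ) → Set
NonNeg f = ∀ S → 0ℚ ≤ f S

-- Write 𝔼f A E for the expectation of f (A ∪ (R ∩ E)). Walking down the tree with A the
-- accepted and E the probed elements so far, the potential inequality
--   adap + 2 𝔼f ∅ E  ≤  2 alg + 𝔼f A E
-- holds at every node. At a leaf it is f A ≤ 𝔼f A E (monotonicity; monotonicity also makes
-- f^max = f). At a node probing a fresh e, whether e ∈ R is independent of R ∩ E, so every
-- potential splits into a p_e-mixture, and the two induction hypotheses combine thanks to
-- 𝔼f (A ∪ {e}) E + 𝔼f ∅ E ≤ 𝔼f A E + 𝔼f {e} E (submodularity) and 𝔼f ∅ E ≤ 𝔼f {e} E.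
-- At the root both potentials are 𝔼f ∅ ∅ ≥ 0, so in fact adap ≤ 2 alg.

module Submission where

open import Defs
open import Data.Nat using (ℕ; zero; suc)
open import Data.Fin using (Fin; zero; suc)
open import Data.Fin.Subset using (Subset; ⊥; ⁅_⁆; _∉_; _⊆_; _∩_; _∪_; inside; outside)
open import Data.Fin.Subset.Properties
  using (∪-identityˡ; ∪-identityʳ; ∪-idempotentCommutativeMonoid; p⊆p∪q; q⊆p∪q; x∈p∩q⁺;
         ⊆-refl; ⊆-trans; ⊆-reflexive; ⊆-min; out⊆; in⊆in)
open import Data.Vec using ([]; _∷_; here; there)
open import Data.List using (List; []; _∷_; map; _++_; foldr)
open import Data.List.Properties using (map-++; map-∘; map-cong)
open import Data.List.Relation.Unary.All using (All; []; _∷_)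
import Data.List.Relation.Unary.All as All
import Data.List.Relation.Unary.All.Properties as All
open import Data.List.Relation.Unary.Any using (here; there)
open import Data.List.Membership.Propositional using () renaming (_∈_ to _∈ˡ_)
open import Data.List.Membership.Propositional.Properties using (∈-map⁺; ∈-++⁺ʳ)
open import Data.Empty using (⊥-elim)
open import Data.Integer using (+_)
open import Data.Rational using (ℚ; 0ℚ; 1ℚ; _*_; _/_; _≤_; _+_; _-_; -_; _⊔_; nonNegative)
open import Data.Rational.Properties
  using (≤-trans; ≤-antisym; +-mono-≤; +-monoˡ-≤; +-monoʳ-≤; *-monoˡ-≤-nonNeg;
         +-identityˡ; +-identityʳ; *-identityˡ; +-inverseʳ; *-zeroʳ; *-assoc; +-assoc; +-comm; *-distribˡ-+;
         p≤p⊔q; p≤q⇒p≤r⊔q; ⊔-lub; nonNegative⁻¹; nonNeg+nonNeg⇒nonNeg; nonNeg*nonNeg⇒nonNeg;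
         module ≤-Reasoning)
open import Data.Rational.Solver using (module +-*-Solver)
open import Data.Product using (_,_)
import Algebra.Solver.IdempotentCommutativeMonoid as ∪-Solver
open import Relation.Binary.PropositionalEquality
  using (_≡_; refl; sym; trans; cong; cong₂; subst; module ≡-Reasoning)
open import Function using (_∘_)

p≤q⇒0≤q-p : ∀ {p q} → p ≤ q → 0ℚ ≤ q - p
p≤q⇒0≤q-p {p} {q} p≤q = begin
  0ℚ     ≡⟨ sym (+-inverseʳ p) ⟩
  p - p  ≤⟨ +-monoˡ-≤ (- p) p≤q ⟩
  q - p  ∎
  where open ≤-Reasoning

+-nonNeg : ∀ {p q} → 0ℚ ≤ p → 0ℚ ≤ q → 0ℚ ≤ p + q
+-nonNeg {p} {q} 0≤p 0≤q =
  nonNegative⁻¹ _ {{nonNeg+nonNeg⇒nonNeg p {{nonNegative 0≤p}} q {{nonNegative 0≤q}}}}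

*-nonNeg : ∀ {p q} → 0ℚ ≤ p → 0ℚ ≤ q → 0ℚ ≤ p * q
*-nonNeg {p} {q} 0≤p 0≤q =
  nonNegative⁻¹ _ {{nonNeg*nonNeg⇒nonNeg p {{nonNegative 0≤p}} q {{nonNegative 0≤q}}}}

≤-by-slack : ∀ {x y} s → 0ℚ ≤ s → y ≡ x + s → x ≤ y
≤-by-slack {x} s 0≤s refl = begin
  x       ≡⟨ sym (+-identityʳ x) ⟩
  x + 0ℚ  ≤⟨ +-monoʳ-≤ x 0≤s ⟩
  x + s   ∎
  where open ≤-Reasoning

module _ where
  open +-*-Solver

  x+[z+z]≤y+z⇒x≤y : ∀ {x y z} → x + (z + z) ≤ y + z → 0ℚ ≤ z → x ≤ y
  x+[z+z]≤y+z⇒x≤y {x} {y} {z} bound 0≤z =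
    ≤-by-slack (((y + z) - (x + (z + z))) + z) (+-nonNeg (p≤q⇒0≤q-p bound) 0≤z)
      (solve 3 (λ x y z → y := x :+ (((y :+ z) :- (x :+ (z :+ z))) :+ z)) refl x y z)

  x≤y+y⇒⅓*x≤y : ∀ {x y} → x ≤ y + y → 0ℚ ≤ y → (+ 1 / 3) * x ≤ y
  x≤y+y⇒⅓*x≤y {x} {y} x≤2y 0≤y =
    ≤-by-slack (⅓ * ((y + y) - x) + ⅓ * y) (+-nonNeg (*-nonNeg 0≤⅓ (p≤q⇒0≤q-p x≤2y)) (*-nonNeg 0≤⅓ 0≤y))
      (solve 2 (λ x y → y := con ⅓ :* x :+ (con ⅓ :* ((y :+ y) :- x) :+ con ⅓ :* y)) refl x y)
    where
    ⅓ = + 1 / 3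
    0≤⅓ : 0ℚ ≤ ⅓
    0≤⅓ = nonNegative⁻¹ ⅓

mix : ℚ → ℚ → ℚ → ℚ
mix r x y = r * x + (1ℚ - r) * y

module _ where
  open +-*-Solver

  mix-idem : ∀ r x → mix r x x ≡ x
  mix-idem = solve 2 (λ r x → r :* x :+ (con 1ℚ :- r) :* x := x) refl

  mix-+ : ∀ r a b c d → mix r (a + b) (c + d) ≡ mix r a c + mix r b d
  mix-+ = solve 5 (λ r a b c d →
    r :* (a :+ b) :+ (con 1ℚ :- r) :* (c :+ d)
      := (r :* a :+ (con 1ℚ :- r) :* c) :+ (r :* b :+ (con 1ℚ :- r) :* d)) refl

  mix-interchange : ∀ r s a b c d →
    mix r (mix s a b) (mix s c d) ≡ mix s (mix r a c) (mix r b d)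
  mix-interchange = solve 6 (λ r s a b c d →
    let mixₑ t x y = t :* x :+ (con 1ℚ :- t) :* y
    in mixₑ r (mixₑ s a b) (mixₑ s c d) := mixₑ s (mixₑ r a c) (mixₑ r b d)) refl

mix-mono : ∀ {r x x′ y y′} → 0ℚ ≤ r → r ≤ 1ℚ → x ≤ x′ → y ≤ y′ → mix r x y ≤ mix r x′ y′
mix-mono {r} 0≤r r≤1 x≤x′ y≤y′ =
  +-mono-≤ (*-monoˡ-≤-nonNeg r {{nonNegative 0≤r}} x≤x′)
           (*-monoˡ-≤-nonNeg (1ℚ - r) {{nonNegative (p≤q⇒0≤q-p r≤1)}} y≤y′)

mix-nonNeg : ∀ {r x y} → 0ℚ ≤ r → r ≤ 1ℚ → 0ℚ ≤ x → 0ℚ ≤ y → 0ℚ ≤ mix r x y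
mix-nonNeg {r} 0≤r r≤1 0≤x 0≤y =
  subst (_≤ mix r _ _) (mix-idem r 0ℚ) (mix-mono 0≤r r≤1 0≤x 0≤y)

-- Expectation over the random set R

𝔼 : ∀ {n} → (Fin n → ℚ) → (Subset n → ℚ) → ℚ
𝔼 {zero}  p g = g []
𝔼 {suc n} p g = mix (p zero) (𝔼 (p ∘ suc) (g ∘ (inside ∷_))) (𝔼 (p ∘ suc) (g ∘ (outside ∷_)))

𝔼-cong : ∀ {n} (p : Fin n → ℚ) {g h} → (∀ R → g R ≡ h R) → 𝔼 p g ≡ 𝔼 p h
𝔼-cong {zero}  p g≡h = g≡h []
𝔼-cong {suc n} p g≡h =
  cong₂ (mix (p zero)) (𝔼-cong (p ∘ suc) (g≡h ∘ (inside ∷_))) (𝔼-cong (p ∘ suc) (g≡h ∘ (outside ∷_)))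

𝔼-const : ∀ {n} (p : Fin n → ℚ) c → 𝔼 p (λ _ → c) ≡ c
𝔼-const {zero}  p c = refl
𝔼-const {suc n} p c =
  trans (cong₂ (mix (p zero)) (𝔼-const (p ∘ suc) c) (𝔼-const (p ∘ suc) c)) (mix-idem (p zero) c)

𝔼-+ : ∀ {n} (p : Fin n → ℚ) g h → 𝔼 p (λ R → g R + h R) ≡ 𝔼 p g + 𝔼 p h
𝔼-+ {zero}  p g h = refl
𝔼-+ {suc n} p g h =
  trans (cong₂ (mix (p zero)) (𝔼-+ (p ∘ suc) _ _) (𝔼-+ (p ∘ suc) _ _)) (mix-+ (p zero) _ _ _ _)

𝔼-mono : ∀ {n} {p : Fin n → ℚ} → (∀ e → 0ℚ ≤ p e) → (∀ e → p e ≤ 1ℚ) →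
  ∀ {g h} → (∀ R → g R ≤ h R) → 𝔼 p g ≤ 𝔼 p h
𝔼-mono {zero}  0≤p p≤1 g≤h = g≤h []
𝔼-mono {suc n} 0≤p p≤1 g≤h = mix-mono (0≤p zero) (p≤1 zero)
  (𝔼-mono (0≤p ∘ suc) (p≤1 ∘ suc) (g≤h ∘ (inside ∷_)))
  (𝔼-mono (0≤p ∘ suc) (p≤1 ∘ suc) (g≤h ∘ (outside ∷_)))

𝔼-fresh : ∀ {n} (p : Fin n → ℚ) (h : Subset n → ℚ) {E e} → e ∉ E →
  𝔼 p (λ R → h (R ∩ (E ∪ ⁅ e ⁆))) ≡
  mix (p e) (𝔼 p (λ R → h ((R ∩ E) ∪ ⁅ e ⁆))) (𝔼 p (λ R → h (R ∩ E)))
𝔼-fresh p h {inside ∷ E} {zero} e∉E = ⊥-elim (e∉E here)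
𝔼-fresh p h {outside ∷ E} {zero} _ = begin
  mix p₀ (𝔼 p′ (λ R → h (inside ∷ (R ∩ (E ∪ ⊥))))) (𝔼 p′ (λ R → h (outside ∷ (R ∩ (E ∪ ⊥)))))
    ≡⟨ cong₂ (mix p₀) (𝔼-cong p′ (λ R → cong (λ S → h (inside ∷ (R ∩ S))) (∪-identityʳ E)))
                      (𝔼-cong p′ (λ R → cong (λ S → h (outside ∷ (R ∩ S))) (∪-identityʳ E))) ⟩
  mix p₀ X₁ X₀
    ≡⟨ sym (cong₂ (mix p₀) (mix-idem p₀ X₁) (mix-idem p₀ X₀)) ⟩
  mix p₀ (mix p₀ X₁ X₁) (mix p₀ X₀ X₀)
    ≡⟨ cong (λ x → mix p₀ (mix p₀ x x) (mix p₀ X₀ X₀))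
            (𝔼-cong p′ (λ R → cong (λ S → h (inside ∷ S)) (sym (∪-identityʳ (R ∩ E))))) ⟩
  mix p₀ (mix p₀ (𝔼 p′ (λ R → h (inside ∷ ((R ∩ E) ∪ ⊥)))) (𝔼 p′ (λ R → h (inside ∷ ((R ∩ E) ∪ ⊥)))))
         (mix p₀ X₀ X₀)  ∎
  where
  open ≡-Reasoning
  p₀ = p zero
  p′ = p ∘ suc
  X₁ = 𝔼 p′ (λ R → h (inside ∷ (R ∩ E)))
  X₀ = 𝔼 p′ (λ R → h (outside ∷ (R ∩ E)))
𝔼-fresh p h {outside ∷ E} {suc e} e∉E =
  trans (cong₂ (mix (p zero)) (𝔼-fresh (p ∘ suc) (h ∘ (outside ∷_)) (e∉E ∘ there))
                              (𝔼-fresh (p ∘ suc) (h ∘ (outside ∷_)) (e∉E ∘ there)))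
        (mix-interchange (p zero) (p (suc e)) _ _ _ _)
𝔼-fresh p h {inside ∷ E} {suc e} e∉E =
  trans (cong₂ (mix (p zero)) (𝔼-fresh (p ∘ suc) (h ∘ (inside ∷_)) (e∉E ∘ there))
                              (𝔼-fresh (p ∘ suc) (h ∘ (outside ∷_)) (e∉E ∘ there)))
        (mix-interchange (p zero) (p (suc e)) _ _ _ _)

sumℚ-++ : ∀ xs ys → sumℚ (xs ++ ys) ≡ sumℚ xs + sumℚ ys
sumℚ-++ []       ys = sym (+-identityˡ _)
sumℚ-++ (x ∷ xs) ys = trans (cong (_+_ x) (sumℚ-++ xs ys)) (sym (+-assoc x _ _))

sumℚ-map-*ˡ : ∀ {A : Set} c (g : A → ℚ) xs → sumℚ (map (λ x → c * g x) xs) ≡ c * sumℚ (map g xs)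
sumℚ-map-*ˡ c g []       = sym (*-zeroʳ c)
sumℚ-map-*ˡ c g (x ∷ xs) = trans (cong (_+_ (c * g x)) (sumℚ-map-*ˡ c g xs)) (sym (*-distribˡ-+ c _ _))

sumℚ-probSet≡𝔼 : ∀ {n} (p : Fin n → ℚ) g →
  sumℚ (map (λ R → probSet p R * g R) (allSubsets n)) ≡ 𝔼 p g
sumℚ-probSet≡𝔼 {zero}  p g = trans (+-identityʳ _) (*-identityˡ _)
sumℚ-probSet≡𝔼 {suc n} p g = begin
  sumℚ (map F (map (outside ∷_) L ++ map (inside ∷_) L))
    ≡⟨ cong sumℚ (map-++ F (map (outside ∷_) L) _) ⟩
  sumℚ (map F (map (outside ∷_) L) ++ map F (map (inside ∷_) L))
    ≡⟨ sumℚ-++ (map F (map (outside ∷_) L)) _ ⟩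
  sumℚ (map F (map (outside ∷_) L)) + sumℚ (map F (map (inside ∷_) L))
    ≡⟨ cong₂ _+_ (branch outside (1ℚ - p zero) (λ _ → refl)) (branch inside (p zero) (λ _ → refl)) ⟩
  (1ℚ - p zero) * 𝔼 (p ∘ suc) (g ∘ (outside ∷_)) + p zero * 𝔼 (p ∘ suc) (g ∘ (inside ∷_))
    ≡⟨ +-comm ((1ℚ - p zero) * 𝔼 (p ∘ suc) (g ∘ (outside ∷_))) _ ⟩
  𝔼 p g  ∎
  where
  open ≡-Reasoning
  L = allSubsets n
  F : Subset (suc n) → ℚ
  F R = probSet p R * g R
  branch : ∀ b c → (∀ R → probSet p (b ∷ R) ≡ c * probSet (p ∘ suc) R) →
    sumℚ (map F (map (b ∷_) L)) ≡ c * 𝔼 (p ∘ suc) (g ∘ (b ∷_))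
  branch b c weight = begin
    sumℚ (map F (map (b ∷_) L))
      ≡⟨ cong sumℚ (sym (map-∘ L)) ⟩
    sumℚ (map (F ∘ (b ∷_)) L)
      ≡⟨ cong sumℚ (map-cong (λ R → trans (cong (_* g (b ∷ R)) (weight R)) (*-assoc c _ _)) L) ⟩
    sumℚ (map (λ R → c * (probSet (p ∘ suc) R * g (b ∷ R))) L)
      ≡⟨ sumℚ-map-*ˡ c _ L ⟩
    c * sumℚ (map (λ R → probSet (p ∘ suc) R * g (b ∷ R)) L)
      ≡⟨ cong (c *_) (sumℚ-probSet≡𝔼 (p ∘ suc) (g ∘ (b ∷_))) ⟩
    c * 𝔼 (p ∘ suc) (g ∘ (b ∷_))  ∎

-- f^max of a monotone function

subsetsOf-⊆ : ∀ {n} (S : Subset n) → All (_⊆ S) (subsetsOf S)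
subsetsOf-⊆ []            = ⊆-refl ∷ []
subsetsOf-⊆ (outside ∷ S) = All.gmap⁺ out⊆ (subsetsOf-⊆ S)
subsetsOf-⊆ (inside ∷ S)  = All.++⁺ (All.gmap⁺ out⊆ (subsetsOf-⊆ S)) (All.gmap⁺ in⊆in (subsetsOf-⊆ S))

∈-subsetsOf : ∀ {n} (S : Subset n) → S ∈ˡ subsetsOf S
∈-subsetsOf []            = here refl
∈-subsetsOf (outside ∷ S) = ∈-map⁺ (outside ∷_) (∈-subsetsOf S)
∈-subsetsOf (inside ∷ S)  = ∈-++⁺ʳ (map (outside ∷_) (subsetsOf S)) (∈-map⁺ (inside ∷_) (∈-subsetsOf S))

foldr-⊔-lub : ∀ {b c} {xs : List ℚ} → b ≤ c → All (_≤ c) xs → foldr _⊔_ b xs ≤ c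
foldr-⊔-lub b≤c []           = b≤c
foldr-⊔-lub b≤c (x≤c ∷ xs≤c) = ⊔-lub x≤c (foldr-⊔-lub b≤c xs≤c)

foldr-⊔-ub : ∀ b {x} {xs : List ℚ} → x ∈ˡ xs → x ≤ foldr _⊔_ b xs
foldr-⊔-ub b {xs = x ∷ xs} (here refl) = p≤p⊔q x _
foldr-⊔-ub b {xs = y ∷ xs} (there x∈xs) = p≤q⇒p≤r⊔q y (foldr-⊔-ub b x∈xs)

fmax≡f : ∀ {n} {f : Subset n → ℚ} → Monotone f → ∀ S → fmax f S ≡ f S
fmax≡f {f = f} mono S = ≤-antisym
  (foldr-⊔-lub (mono ⊥ S (⊆-min S)) (All.gmap⁺ (λ {T} → mono T S) (subsetsOf-⊆ S)))
  (foldr-⊔-ub (f ⊥) (∈-map⁺ f (∈-subsetsOf S)))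

module _ {n} {f : Subset n → ℚ} (mono : Monotone f) (submod : Submodular f) where
  open ∪-Solver (∪-idempotentCommutativeMonoid n) using (solve; _⊜_; _⊕_)

  submodular⇒diminishing : ∀ A B S → f ((A ∪ B) ∪ S) + f S ≤ f (A ∪ S) + f (B ∪ S)
  submodular⇒diminishing A B S = begin
    f ((A ∪ B) ∪ S) + f S
      ≡⟨ cong (λ X → f X + f S) (solve 3 (λ A B S → (A ⊕ B) ⊕ S ⊜ (A ⊕ S) ⊕ (B ⊕ S)) refl A B S) ⟩
    f ((A ∪ S) ∪ (B ∪ S)) + f S
      ≤⟨ +-monoʳ-≤ (f ((A ∪ S) ∪ (B ∪ S))) (mono S _ (λ x∈S → x∈p∩q⁺ (q⊆p∪q A S x∈S , q⊆p∪q B S x∈S))) ⟩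
    f ((A ∪ S) ∪ (B ∪ S)) + f ((A ∪ S) ∩ (B ∪ S))
      ≤⟨ submod (A ∪ S) (B ∪ S) ⟩
    f (A ∪ S) + f (B ∪ S)  ∎
    where open ≤-Reasoning

-- The potential argument

module _ where
  open +-*-Solver

  -- The slack is r·(gap of yes) + (1 - r)·(gap of no) + r(2 - r)·(gap of exchange) + r²·(w - z).
  node-step : ∀ r a₁ a₀ g₁ g₀ u v w z → 0ℚ ≤ r → r ≤ 1ℚ →
    a₁ + (mix r w z + mix r w z) ≤ (g₁ + g₁) + u →
    a₀ + (mix r w z + mix r w z) ≤ (g₀ + g₀) + mix r u v →
    u + z ≤ v + w → z ≤ w →
    mix r a₁ a₀ + (z + z) ≤ (mix r g₁ g₀ + mix r g₁ g₀) + v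
  node-step r a₁ a₀ g₁ g₀ u v w z 0≤r r≤1 yes no exchange z≤w =
    ≤-by-slack slack 0≤slack
      (solve 9 (λ r a₁ a₀ g₁ g₀ u v w z →
        let q = con 1ℚ :- r
            mixₑ x y = r :* x :+ q :* y
            Φ = mixₑ w z
        in (mixₑ g₁ g₀ :+ mixₑ g₁ g₀) :+ v
           := (mixₑ a₁ a₀ :+ (z :+ z))
              :+ (r :* (((g₁ :+ g₁) :+ u) :- (a₁ :+ (Φ :+ Φ)))
                  :+ q :* (((g₀ :+ g₀) :+ mixₑ u v) :- (a₀ :+ (Φ :+ Φ)))
                  :+ (r :* (con 1ℚ :+ q)) :* ((v :+ w) :- (u :+ z))
                  :+ (r :* r) :* (w :- z))) refl r a₁ a₀ g₁ g₀ u v w z)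
    where
    q = 1ℚ - r
    Φ = mix r w z
    slack = r * (((g₁ + g₁) + u) - (a₁ + (Φ + Φ)))
            + q * (((g₀ + g₀) + mix r u v) - (a₀ + (Φ + Φ)))
            + (r * (1ℚ + q)) * ((v + w) - (u + z))
            + (r * r) * (w - z)
    0≤q : 0ℚ ≤ q
    0≤q = p≤q⇒0≤q-p r≤1
    0≤slack : 0ℚ ≤ slack
    0≤slack =
      +-nonNeg (+-nonNeg (+-nonNeg (*-nonNeg 0≤r (p≤q⇒0≤q-p yes)) (*-nonNeg 0≤q (p≤q⇒0≤q-p no)))
                         (*-nonNeg (*-nonNeg 0≤r (+-nonNeg (≤-trans 0≤r r≤1) 0≤q)) (p≤q⇒0≤q-p exchange)))
               (*-nonNeg (*-nonNeg 0≤r 0≤r) (p≤q⇒0≤q-p z≤w))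

module Potential {n} (p : Fin n → ℚ) (0≤p : ∀ e → 0ℚ ≤ p e) (p≤1 : ∀ e → p e ≤ 1ℚ)
                 {f : Subset n → ℚ} (mono : Monotone f) (submod : Submodular f) where
  open ∪-Solver (∪-idempotentCommutativeMonoid n) using (solve; _⊜_; _⊕_)

  𝔼f : Subset n → Subset n → ℚ
  𝔼f A E = 𝔼 p (λ R → f (A ∪ (R ∩ E)))

  f≤𝔼f : ∀ A E → f A ≤ 𝔼f A E
  f≤𝔼f A E = subst (_≤ 𝔼f A E) (𝔼-const p (f A)) (𝔼-mono 0≤p p≤1 (λ R → mono A _ (p⊆p∪q (R ∩ E))))

  𝔼f⊥≤𝔼f : ∀ A E → 𝔼f ⊥ E ≤ 𝔼f A E
  𝔼f⊥≤𝔼f A E = 𝔼-mono 0≤p p≤1 (λ R →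
    mono _ _ (⊆-trans (⊆-reflexive (∪-identityˡ (R ∩ E))) (q⊆p∪q A (R ∩ E))))

  𝔼f-submodular : ∀ A B E → 𝔼f (A ∪ B) E + 𝔼f ⊥ E ≤ 𝔼f A E + 𝔼f B E
  𝔼f-submodular A B E = begin
    𝔼f (A ∪ B) E + 𝔼f ⊥ E
      ≡⟨ sym (𝔼-+ p _ _) ⟩
    𝔼 p (λ R → f ((A ∪ B) ∪ (R ∩ E)) + f (⊥ ∪ (R ∩ E)))
      ≤⟨ 𝔼-mono 0≤p p≤1 pointwise ⟩
    𝔼 p (λ R → f (A ∪ (R ∩ E)) + f (B ∪ (R ∩ E)))
      ≡⟨ 𝔼-+ p _ _ ⟩
    𝔼f A E + 𝔼f B E  ∎
    where
    open ≤-Reasoning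
    pointwise : ∀ R → f ((A ∪ B) ∪ (R ∩ E)) + f (⊥ ∪ (R ∩ E)) ≤ f (A ∪ (R ∩ E)) + f (B ∪ (R ∩ E))
    pointwise R rewrite ∪-identityˡ (R ∩ E) = submodular⇒diminishing mono submod A B (R ∩ E)

  𝔼f-fresh : ∀ A {E e} → e ∉ E → 𝔼f A (E ∪ ⁅ e ⁆) ≡ mix (p e) (𝔼f (A ∪ ⁅ e ⁆) E) (𝔼f A E)
  𝔼f-fresh A {E} {e} e∉E =
    trans (𝔼-fresh p (λ S → f (A ∪ S)) e∉E)
          (cong (λ x → mix (p e) x (𝔼f A E))
                (𝔼-cong p (λ R → cong f (regroup A (R ∩ E) ⁅ e ⁆))))
    where
    regroup : ∀ A S T → A ∪ (S ∪ T) ≡ (A ∪ T) ∪ S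
    regroup = solve 3 (λ A S T → A ⊕ (S ⊕ T) ⊜ (A ⊕ T) ⊕ S) refl

  expR≡𝔼f⊥ : ∀ E → expR p f E ≡ 𝔼f ⊥ E
  expR≡𝔼f⊥ E = trans (sumℚ-probSet≡𝔼 p _)
                     (𝔼-cong p (λ R → trans (fmax≡f mono (R ∩ E)) (cong f (sym (∪-identityˡ (R ∩ E))))))

  subst-potentials : ∀ x y {Φ Ψ W V} → Φ ≡ Ψ → W ≡ V →
    x + (Φ + Φ) ≤ y + W → x + (Ψ + Ψ) ≤ y + V
  subst-potentials x y refl refl bound = bound

  potential-bound : ∀ t E A → ValidFrom E t →
    adapFrom p f A t + (𝔼f ⊥ E + 𝔼f ⊥ E) ≤ (algFrom p f E t + algFrom p f E t) + 𝔼f A E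
  potential-bound leaf E A _ = begin
    fmax f A + (Φ + Φ)     ≡⟨ cong (_+ (Φ + Φ)) (fmax≡f mono A) ⟩
    f A + (Φ + Φ)          ≤⟨ +-monoˡ-≤ (Φ + Φ) (f≤𝔼f A E) ⟩
    𝔼f A E + (Φ + Φ)       ≡⟨ +-comm (𝔼f A E) (Φ + Φ) ⟩
    (Φ + Φ) + 𝔼f A E       ≡⟨ cong (λ x → (x + x) + 𝔼f A E) (sym (expR≡𝔼f⊥ E)) ⟩
    (expR p f E + expR p f E) + 𝔼f A E  ∎
    where
    open ≤-Reasoning
    Φ = 𝔼f ⊥ E
  potential-bound (node e t₁ t₀) E A (e∉E , valid₁ , valid₀) =
    node-step (p e) a₁ a₀ g₁ g₀ (𝔼f (A ∪ ⁅ e ⁆) E) (𝔼f A E) (𝔼f ⁅ e ⁆ E) (𝔼f ⊥ E) (0≤p e) (p≤1 e)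
      (subst-potentials a₁ (g₁ + g₁) baseline accepted (potential-bound t₁ E′ (A ∪ ⁅ e ⁆) valid₁))
      (subst-potentials a₀ (g₀ + g₀) baseline (𝔼f-fresh A e∉E) (potential-bound t₀ E′ A valid₀))
      (𝔼f-submodular A ⁅ e ⁆ E) (𝔼f⊥≤𝔼f ⁅ e ⁆ E)
    where
    E′ = E ∪ ⁅ e ⁆
    a₁ = adapFrom p f (A ∪ ⁅ e ⁆) t₁
    a₀ = adapFrom p f A t₀
    g₁ = algFrom p f E′ t₁
    g₀ = algFrom p f E′ t₀
    baseline : 𝔼f ⊥ E′ ≡ mix (p e) (𝔼f ⁅ e ⁆ E) (𝔼f ⊥ E)
    baseline = trans (𝔼f-fresh ⊥ e∉E) (cong (λ X → mix (p e) (𝔼f X E) (𝔼f ⊥ E)) (∪-identityˡ ⁅ e ⁆))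
    accepted : 𝔼f (A ∪ ⁅ e ⁆) E′ ≡ 𝔼f (A ∪ ⁅ e ⁆) E
    accepted = begin
      𝔼f (A ∪ ⁅ e ⁆) E′
        ≡⟨ 𝔼f-fresh (A ∪ ⁅ e ⁆) e∉E ⟩
      mix (p e) (𝔼f ((A ∪ ⁅ e ⁆) ∪ ⁅ e ⁆) E) (𝔼f (A ∪ ⁅ e ⁆) E)
        ≡⟨ cong (λ X → mix (p e) (𝔼f X E) (𝔼f (A ∪ ⁅ e ⁆) E))
                (solve 2 (λ A T → (A ⊕ T) ⊕ T ⊜ A ⊕ T) refl A ⁅ e ⁆) ⟩
      mix (p e) (𝔼f (A ∪ ⁅ e ⁆) E) (𝔼f (A ∪ ⁅ e ⁆) E)
        ≡⟨ mix-idem (p e) _ ⟩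
      𝔼f (A ∪ ⁅ e ⁆) E  ∎
      where open ≡-Reasoning

  alg-nonNeg : NonNeg f → ∀ t E → 0ℚ ≤ algFrom p f E t
  alg-nonNeg nonneg leaf E =
    subst (0ℚ ≤_) (sym (expR≡𝔼f⊥ E)) (≤-trans (nonneg ⊥) (f≤𝔼f ⊥ E))
  alg-nonNeg nonneg (node e t₁ t₀) E =
    mix-nonNeg (0≤p e) (p≤1 e) (alg-nonNeg nonneg t₁ _) (alg-nonNeg nonneg t₀ _)

theorem5 : (n : ℕ) (p : Fin n → ℚ) → (∀ e → 0ℚ ≤ p e) → (∀ e → p e ≤ 1ℚ) →
    (t : Tree n) → Valid t →
    (f : Subset n → ℚ) → Monotone f → NonNeg f → Submodular f → f ⊥ ≡ 0ℚ →
    (+ 1 / 3) * adap p t f ≤ alg p t f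
theorem5 n p 0≤p p≤1 t valid f mono nonneg submod _ = x≤y+y⇒⅓*x≤y adap≤2alg (alg-nonNeg nonneg t ⊥)
  where
  open Potential p 0≤p p≤1 mono submod
  adap≤2alg : adap p t f ≤ alg p t f + alg p t f
  adap≤2alg = x+[z+z]≤y+z⇒x≤y (potential-bound t ⊥ ⊥ valid) (≤-trans (nonneg ⊥) (f≤𝔼f ⊥ ⊥))
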